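{- Let $P$ be a finite ordered set of height $1$ such that: (1) $P$ has $w\geq 3$ minimal elements; (2) there is an $\ell\in\{1,\ldots,w-1\}$ such that every maximal element is above exactly $\ell$ minimal elements; (3) $P$ does not contain any nontrivial order-autonomous antichains; (4) $\{\Phi|_{R_0}:\Phi\in\mathrm{Aut}(P)\}$ contains the alternating group on $R_0$. Then $R_1$ has exactly $\binom{w}{\ell}$ elements. For $\ell\geq 2$, $P$ is isomorphic to the ordered set consisting of the singleton subsets and the $\ell$-element subsets of $R_0$ ordered by inclusion. For $\ell=1$, $P$ is isomorphic to $wC_2$.
   Context: $R_0$ is the set of minimal elements and $R_1$ the set of elements minimal in $P\setminus R_0$ (here the maximal, non-minimal elements). A nonempty $A\subseteq P$ is order-autonomous if for every $z\in P\setminus A$: $z<a$ for some $a\in A$ implies $z$ below all of $A$, and $z>a$ for some $a\in A$ implies $z$ above all of $A$; nontrivial means $|A|\notin\{1,|P|\}$. $wC_2$ is the disjoint union of $w$ two-element chains. -}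

module Defs where

open import Data.Nat using (ℕ; zero; suc)
open import Data.Fin using (Fin; _≟_)
open import Data.Fin.Properties using (all?)
open import Data.Fin.Subset using (Subset; _∈_; _⊆_; _⊂_; ∣_∣; Nonempty)
open import Data.Vec using (tabulate)
open import Data.Bool using (Bool; true; false; if_then_else_)
open import Data.Product using (Σ; ∃; _×_; _,_)
open import Data.Sum using (_⊎_)
open import Data.Empty using (⊥)
open import Function using (_∘_; id)
open import Function.Bundles using (_↔_; Inverse)
open import Relation.Nullary using (¬_; Dec; does; yes; no; ¬?)
open import Relation.Nullary.Decidable using (_→-dec_)
open import Data.Bool using (_∧_)
open import Relation.Binary using (Decidable)
open import Relation.Binary.PropositionalEquality using (_≡_; _≢_)

record FinPoset (n : ℕ) : Set₁ where
  field
    _<_     : Fin n → Fin n → Set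
    irrefl  : ∀ x → ¬ (x < x)
    trans   : ∀ {x y z} → x < y → y < z → x < z
    _<?_    : Decidable _<_

module _ {n : ℕ} (P : FinPoset n) where
  open FinPoset P

  Height1 : Set
  Height1 = (∃ λ x → ∃ λ y → x < y)
          × ¬ (∃ λ x → ∃ λ y → ∃ λ z → (x < y) × (y < z))

  Minimal : Fin n → Set
  Minimal x = ∀ y → ¬ (y < x)

  Maximal : Fin n → Set
  Maximal x = ∀ y → ¬ (x < y)

  minimal? : ∀ x → Dec (Minimal x)
  minimal? x = all? (λ y → ¬? (y <? x))

  R₀ : Subset n
  R₀ = tabulate (λ x → does (minimal? x))

  -- R₁: elements minimal in P ∖ R₀
  InR₁ : Fin n → Set
  InR₁ x = ¬ Minimal x × (∀ y → y < x → Minimal y)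

  InR₁? : ∀ x → Dec (InR₁ x)
  InR₁? x with minimal? x
  ... | yes m = no λ { (nm , _) → nm m }
  ... | no nm with all? (λ y → (y <? x) →-dec (minimal? y))
  ... | yes h = yes (nm , h)
  ... | no ¬h = no λ { (_ , h) → ¬h h }

  R₁ : Subset n
  R₁ = tabulate (λ x → does (InR₁? x))

  MinBelow : Fin n → Subset n
  MinBelow x = tabulate (λ m → does (minimal? m) ∧ does (m <? x))

  Antichain : Subset n → Set
  Antichain A = ∀ a b → a ∈ A → b ∈ A → ¬ (a < b)

  OrderAutonomous : Subset n → Set
  OrderAutonomous A = Nonempty A ×
    (∀ z → ¬ (z ∈ A) →
      ((∃ λ a → a ∈ A × z < a) → ∀ a → a ∈ A → z < a) ×
      ((∃ λ a → a ∈ A × a < z) → ∀ a → a ∈ A → a < z))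

  Nontrivial : Subset n → Set
  Nontrivial A = ¬ (∣ A ∣ ≡ 1) × ¬ (∣ A ∣ ≡ n)

  record Aut : Set where
    field
      perm     : Fin n ↔ Fin n
    open Inverse perm public using (to)
    field
      preserve : ∀ x y → x < y → to x < to y
      reflect  : ∀ x y → to x < to y → x < y

-- Transpositions and even permutations of a subset S of Fin n
-- (permutations of Fin n fixing the complement of S, written as
-- products of an even number of transpositions of elements of S).

swap : ∀ {n} → Fin n → Fin n → Fin n → Fin n
swap a b x with does (x ≟ a) | does (x ≟ b)
... | true  | _     = b
... | false | true  = a
... | false | false = x

data EvenPermOn {n : ℕ} (S : Subset n) : (Fin n → Fin n) → Set where
  idE   : EvenPermOn S id
  stepE : ∀ {σ} a b c d → a ∈ S → b ∈ S → c ∈ S → d ∈ S → a ≢ b → c ≢ d →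
          EvenPermOn S σ → EvenPermOn S (swap a b ∘ swap c d ∘ σ)

_<wC₂_ : ∀ {w} → Fin w × Bool → Fin w × Bool → Set
(i , false) <wC₂ (j , true) = i ≡ j
(i , _)     <wC₂ (j , _)    = ⊥

module _ {n : ℕ} (P : FinPoset n) where
  open FinPoset P

  IsoToSubsetPoset : ℕ → Set
  IsoToSubsetPoset ℓ =
    Σ (Fin n → Subset n) λ f →
      (∀ x → f x ⊆ R₀ P × (∣ f x ∣ ≡ 1 ⊎ ∣ f x ∣ ≡ ℓ)) ×
      (∀ x y → f x ≡ f y → x ≡ y) ×
      (∀ S → S ⊆ R₀ P → (∣ S ∣ ≡ 1 ⊎ ∣ S ∣ ≡ ℓ) → ∃ λ x → f x ≡ S) ×
      (∀ x y → (x < y → f x ⊂ f y) × (f x ⊂ f y → x < y))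

  IsoToWC₂ : ℕ → Set
  IsoToWC₂ w =
    Σ (Fin n ↔ (Fin w × Bool)) λ e →
      ∀ x y → (x < y → Inverse.to e x <wC₂ Inverse.to e y)
            × (Inverse.to e x <wC₂ Inverse.to e y → x < y)

{-# OPTIONS --safe #-}
module Submission where

-- x ↦ MinBelow x maps R₁ (the non-minimal, hence maximal, elements) bijectively onto the
-- ℓ-subsets of R₀. It is injective because two maximal elements with the same lower set
-- would form a nontrivial autonomous antichain. For surjectivity, an automorphism acting
-- on R₀ as a 3-cycle through a ∈ MinBelow x, b ∉ MinBelow x and a third minimal element
-- moves x to an element whose lower set is MinBelow x with a exchanged for b, and such
-- exchanges reach every ℓ-subset. Counting ℓ-subsets gives ∣R₁∣ = w C ℓ; sending minimal
-- elements to singletons gives the isomorphism for ℓ ≥ 2, and for ℓ = 1 each maximal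
-- element is paired with the unique minimal element below it.

open import Defs
open import Data.Bool using (Bool; true; false; if_then_else_)
import Data.Bool as Bool
open import Data.Empty using (⊥; ⊥-elim)
open import Data.Fin using (Fin; zero; suc; _≟_)
open import Data.Fin.Properties using (suc-injective; 0≢1+n; any?)
open import Data.Fin.Subset hiding (⊥)
open import Data.Fin.Subset.Properties
open import Data.Nat using (ℕ; zero; suc; _+_; _≤_; _<_; z≤n; s≤s)
  renaming (_≟_ to _≟ℕ_)
open import Data.Nat.Combinatorics using (_C_; nCk+nC[k+1]≡[n+1]C[k+1])
open import Data.Nat.Properties
  using (≤-refl; ≤-reflexive; ≤-trans; ≤-pred; <-irrefl; <-≤-trans; <⇒≱; n≤1+n; +-identityʳ; +-suc; +-comm; +-monoʳ-≤)
  renaming (suc-injective to suc-injectiveℕ)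
open import Data.Product using (Σ; ∃; _×_; _,_; proj₁; proj₂; map₁; map₂)
open import Data.Product.Function.NonDependent.Propositional using (_×-⇔_)
open import Data.Sum using (_⊎_; inj₁; inj₂)
open import Data.Vec using ([]; _∷_; tabulate; here; there)
open import Data.Vec.Properties using (≡-dec; []=⇒lookup; lookup⇒[]=; lookup∘tabulate; ∷-injective)
open import Data.Vec.Properties.WithK using ([]=-irrelevant)
open import Function using (_∘_; case_of_)
open import Function.Bundles using (_⇔_; mk⇔; Equivalence; Inverse; mk↔ₛ′)
open import Function.Properties.Equivalence
  using () renaming (refl to ⇔-refl; sym to ⇔-sym; trans to ⇔-trans)
open import Level using (Level)
open import Relation.Nullary using (¬_; Dec; yes; no; does; ¬?; _×-dec_)
open import Relation.Nullary.Decidable using (toSum; dec-true; dec-false; does-⇔)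
open import Relation.Unary using (Pred; Decidable)
open import Relation.Binary.PropositionalEquality

private variable
  a : Level
  n m : ℕ
  p q : Subset n
  x y : Fin n

∈-tabulate-does : {P : Pred (Fin n) a} (P? : Decidable P) → x ∈ tabulate (λ y → does (P? y)) ⇔ P x
∈-tabulate-does {x = x} {P = P} P? =
  mk⇔ member⇒ (λ px → lookup⇒[]= x _ (trans (lookup∘tabulate _ x) (dec-true (P? x) px)))
  where
  member⇒ : x ∈ tabulate (λ y → does (P? y)) → P x
  member⇒ x∈ with P? x | trans (sym (lookup∘tabulate (λ y → does (P? y)) x)) ([]=⇒lookup x∈)
  ... | yes px | _ = px

⊈⇒∃∈∉ : ¬ (p ⊆ q) → ∃ λ x → x ∈ p × x ∉ q
⊈⇒∃∈∉ {p = []} {[]} p⊈q = ⊥-elim (p⊈q λ ())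
⊈⇒∃∈∉ {p = true ∷ p} {false ∷ q} p⊈q = zero , here , λ ()
⊈⇒∃∈∉ {p = false ∷ p} {_ ∷ q} p⊈q with ⊈⇒∃∈∉ {p = p} {q} (p⊈q ∘ out⊆)
... | x , x∈p , x∉q = suc x , there x∈p , x∉q ∘ drop-there
⊈⇒∃∈∉ {p = true ∷ p} {true ∷ q} p⊈q with ⊈⇒∃∈∉ {p = p} {q} (p⊈q ∘ in⊆in)
... | x , x∈p , x∉q = suc x , there x∈p , x∉q ∘ drop-there

p⊆q∧∣q∣≤∣p∣⇒p≡q : p ⊆ q → ∣ q ∣ ≤ ∣ p ∣ → p ≡ q
p⊆q∧∣q∣≤∣p∣⇒p≡q {p = p} {q} p⊆q ∣q∣≤∣p∣ with q ⊆? p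
... | yes q⊆p = ⊆-antisym p⊆q q⊆p
... | no q⊈p = ⊥-elim (<-irrefl refl (≤-trans (p⊂q⇒∣p∣<∣q∣ (p⊆q , ⊈⇒∃∈∉ q⊈p)) ∣q∣≤∣p∣))

p⊈q∧∣p∣≡∣q∣⇒q⊈p : ¬ (p ⊆ q) → ∣ p ∣ ≡ ∣ q ∣ → ¬ (q ⊆ p)
p⊈q∧∣p∣≡∣q∣⇒q⊈p p⊈q ∣p∣≡∣q∣ q⊆p =
  p⊈q (⊆-reflexive (sym (p⊆q∧∣q∣≤∣p∣⇒p≡q q⊆p (≤-reflexive ∣p∣≡∣q∣))))

0<∣p∣⇒Nonempty : ∀ {n} {p : Subset n} → 0 < ∣ p ∣ → Nonempty p
0<∣p∣⇒Nonempty {n} {p} 0<∣p∣ with nonempty? p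
... | yes nonempty = nonempty
... | no empty =
  ⊥-elim (<-irrefl refl (subst (0 <_) (trans (cong ∣_∣ (Empty-unique empty)) (∣⊥∣≡0 n)) 0<∣p∣))

x∈p⇒⁅x⁆⊆p : x ∈ p → ⁅ x ⁆ ⊆ p
x∈p⇒⁅x⁆⊆p {x = x} x∈p y∈⁅x⁆ rewrite x∈⁅y⁆⇒x≡y x y∈⁅x⁆ = x∈p

⁅⁆-injective : ⁅ x ⁆ ≡ ⁅ y ⁆ → x ≡ y
⁅⁆-injective {x = x} {y} ⁅x⁆≡⁅y⁆ = x∈⁅y⁆⇒x≡y y (subst (x ∈_) ⁅x⁆≡⁅y⁆ (x∈⁅x⁆ x))

x∈p∧∣p∣≡1⇒p≡⁅x⁆ : x ∈ p → ∣ p ∣ ≡ 1 → p ≡ ⁅ x ⁆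
x∈p∧∣p∣≡1⇒p≡⁅x⁆ {x = x} x∈p ∣p∣≡1 =
  sym (p⊆q∧∣q∣≤∣p∣⇒p≡q (x∈p⇒⁅x⁆⊆p x∈p) (≤-reflexive (trans ∣p∣≡1 (sym (∣⁅x⁆∣≡1 x)))))

x∈p∧2≤∣p∣⇒⁅x⁆⊂p : x ∈ p → 2 ≤ ∣ p ∣ → ⁅ x ⁆ ⊂ p
x∈p∧2≤∣p∣⇒⁅x⁆⊂p {x = x} x∈p 2≤∣p∣ = x∈p⇒⁅x⁆⊆p x∈p , ⊈⇒∃∈∉ λ p⊆⁅x⁆ →
  <-irrefl refl (≤-trans 2≤∣p∣ (subst (_ ≤_) (∣⁅x⁆∣≡1 x) (p⊆q⇒∣p∣≤∣q∣ p⊆⁅x⁆)))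

∣p∣≡1⇒∃⁅x⁆ : ∣ p ∣ ≡ 1 → ∃ λ x → p ≡ ⁅ x ⁆
∣p∣≡1⇒∃⁅x⁆ ∣p∣≡1 with 0<∣p∣⇒Nonempty (subst (0 <_) (sym ∣p∣≡1) ≤-refl)
... | x , x∈p = x , x∈p∧∣p∣≡1⇒p≡⁅x⁆ x∈p ∣p∣≡1

∣p∪q∣≤∣p∣+∣q∣ : ∀ (p q : Subset n) → ∣ p ∪ q ∣ ≤ ∣ p ∣ + ∣ q ∣
∣p∪q∣≤∣p∣+∣q∣ [] [] = z≤n
∣p∪q∣≤∣p∣+∣q∣ (false ∷ p) (false ∷ q) = ∣p∪q∣≤∣p∣+∣q∣ p q
∣p∪q∣≤∣p∣+∣q∣ (false ∷ p) (true ∷ q) =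
  subst (suc ∣ p ∪ q ∣ ≤_) (sym (+-suc ∣ p ∣ ∣ q ∣)) (s≤s (∣p∪q∣≤∣p∣+∣q∣ p q))
∣p∪q∣≤∣p∣+∣q∣ (true ∷ p) (false ∷ q) = s≤s (∣p∪q∣≤∣p∣+∣q∣ p q)
∣p∪q∣≤∣p∣+∣q∣ (true ∷ p) (true ∷ q) =
  s≤s (≤-trans (∣p∪q∣≤∣p∣+∣q∣ p q) (+-monoʳ-≤ ∣ p ∣ (n≤1+n ∣ q ∣)))

3≤∣p∣⇒∃z∈p∖⁅x,y⁆ : 3 ≤ ∣ p ∣ → ∀ x y → ∃ λ z → z ∈ p × z ≢ x × z ≢ y
3≤∣p∣⇒∃z∈p∖⁅x,y⁆ {p = p} 3≤∣p∣ x y with p ⊆? ⁅ x ⁆ ∪ ⁅ y ⁆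
... | yes p⊆⁅x,y⁆ =
  ⊥-elim (<-irrefl refl (≤-trans 3≤∣p∣ (≤-trans (p⊆q⇒∣p∣≤∣q∣ p⊆⁅x,y⁆) ∣⁅x,y⁆∣≤2)))
  where
  ∣⁅x,y⁆∣≤2 : ∣ ⁅ x ⁆ ∪ ⁅ y ⁆ ∣ ≤ 2
  ∣⁅x,y⁆∣≤2 = subst₂ (λ i j → ∣ ⁅ x ⁆ ∪ ⁅ y ⁆ ∣ ≤ i + j) (∣⁅x⁆∣≡1 x) (∣⁅x⁆∣≡1 y)
    (∣p∪q∣≤∣p∣+∣q∣ ⁅ x ⁆ ⁅ y ⁆)
... | no p⊈⁅x,y⁆ with ⊈⇒∃∈∉ p⊈⁅x,y⁆
... | z , z∈p , z∉⁅x,y⁆ = z , z∈p , (λ { refl → z∉⁅x,y⁆ (x∈p∪q⁺ (inj₁ (x∈⁅x⁆ x))) })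
                                  , (λ { refl → z∉⁅x,y⁆ (x∈p∪q⁺ (inj₂ (x∈⁅x⁆ y))) })

x∈p─q⇒x∉q : ∀ (p q : Subset n) → x ∈ p ─ q → x ∉ q
x∈p─q⇒x∉q (true ∷ p) (false ∷ q) here ()
x∈p─q⇒x∉q (_ ∷ p) (_ ∷ q) (there x∈p─q) (there x∈q) = x∈p─q⇒x∉q p q x∈p─q x∈q

exchange-─⊂ : ∀ {S T T′ : Subset n} {a b} → a ∉ S → b ∈ S → b ∉ T →
              (∀ y → y ∈ T′ ⇔ ((y ∈ T × y ≢ a) ⊎ y ≡ b)) → S ─ T′ ⊂ S ─ T
exchange-─⊂ {S = S} {T} {T′} {a} {b} a∉S b∈S b∉T T′-members =
  S─T′⊆S─T , b , x∈p∧x∉q⇒x∈p─q b∈S b∉T ,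
  λ b∈S─T′ → x∈p─q⇒x∉q S T′ b∈S─T′ (into-T′ (inj₂ refl))
  where
  into-T′ : ∀ {y} → (y ∈ T × y ≢ a) ⊎ y ≡ b → y ∈ T′
  into-T′ = Equivalence.from (T′-members _)
  S─T′⊆S─T : S ─ T′ ⊆ S ─ T
  S─T′⊆S─T {y} y∈S─T′ = x∈p∧x∉q⇒x∈p─q y∈S λ y∈T →
    x∈p─q⇒x∉q S T′ y∈S─T′ (into-T′ (inj₁ (y∈T , λ { refl → a∉S y∈S })))
    where
    y∈S : y ∈ S
    y∈S = p─q⊆p S T′ y∈S─T′

enum : (p : Subset n) → Fin ∣ p ∣ → Fin n
enum (true ∷ p) zero = zero
enum (true ∷ p) (suc i) = suc (enum p i)
enum (false ∷ p) i = suc (enum p i)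

index : (p : Subset n) → x ∈ p → Fin ∣ p ∣
index (true ∷ p) here = zero
index (true ∷ p) (there x∈p) = suc (index p x∈p)
index (false ∷ p) (there x∈p) = index p x∈p

enum∈ : (p : Subset n) (i : Fin ∣ p ∣) → enum p i ∈ p
enum∈ (true ∷ p) zero = here
enum∈ (true ∷ p) (suc i) = there (enum∈ p i)
enum∈ (false ∷ p) i = there (enum∈ p i)

enum-index : (p : Subset n) (x∈p : x ∈ p) → enum p (index p x∈p) ≡ x
enum-index (true ∷ p) here = refl
enum-index (true ∷ p) (there x∈p) = cong suc (enum-index p x∈p)
enum-index (false ∷ p) (there x∈p) = cong suc (enum-index p x∈p)

index-enum : (p : Subset n) (i : Fin ∣ p ∣) (h : enum p i ∈ p) → index p h ≡ i
index-enum (true ∷ p) zero here = refl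
index-enum (true ∷ p) (suc i) (there h) = cong suc (index-enum p i h)
index-enum (false ∷ p) i (there h) = index-enum p i h

index-cong : (p : Subset n) (x∈p : x ∈ p) (y∈p : y ∈ p) → x ≡ y → index p x∈p ≡ index p y∈p
index-cong p x∈p y∈p refl = cong (index p) ([]=-irrelevant x∈p y∈p)

index-injective : (p : Subset n) (x∈p : x ∈ p) (y∈p : y ∈ p) → index p x∈p ≡ index p y∈p → x ≡ y
index-injective p x∈p y∈p eq =
  trans (sym (enum-index p x∈p)) (trans (cong (enum p) eq) (enum-index p y∈p))

_≟ₛ_ : (S T : Subset n) → Dec (S ≡ T)
_≟ₛ_ = ≡-dec Bool._≟_

countₛ : {Q : Pred (Subset n) a} → Decidable Q → ℕ
countₛ {n = zero} Q? = if does (Q? []) then 1 else 0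
countₛ {n = suc n} Q? = countₛ (λ S → Q? (false ∷ S)) + countₛ (λ S → Q? (true ∷ S))

countₛ-cong : {Q R : Pred (Subset n) a} (Q? : Decidable Q) (R? : Decidable R) →
              (∀ S → Q S ⇔ R S) → countₛ Q? ≡ countₛ R?
countₛ-cong {n = zero} Q? R? Q⇔R = cong (if_then 1 else 0) (does-⇔ (Q⇔R []) (Q? []) (R? []))
countₛ-cong {n = suc n} Q? R? Q⇔R =
  cong₂ _+_ (countₛ-cong _ _ (Q⇔R ∘ (false ∷_))) (countₛ-cong _ _ (Q⇔R ∘ (true ∷_)))

countₛ-empty : {Q : Pred (Subset n) a} (Q? : Decidable Q) → (∀ S → ¬ Q S) → countₛ Q? ≡ 0
countₛ-empty {n = zero} Q? ¬Q rewrite dec-false (Q? []) (¬Q []) = refl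
countₛ-empty {n = suc n} Q? ¬Q =
  cong₂ _+_ (countₛ-empty _ (¬Q ∘ (false ∷_))) (countₛ-empty _ (¬Q ∘ (true ∷_)))

∷≢∷⇔≢ : ∀ {b} {S T : Subset n} → (b ∷ S ≢ b ∷ T) ⇔ (S ≢ T)
∷≢∷⇔≢ {b = b} = mk⇔ (λ ne → ne ∘ cong (b ∷_)) (λ ne → ne ∘ proj₂ ∘ ∷-injective)

private
  module _ {Q : Pred (Subset (suc n)) a} (Q? : Decidable Q) (v : Subset n) where

    without-∷-same : ∀ c → countₛ (λ S → Q? (c ∷ S) ×-dec ¬? ((c ∷ S) ≟ₛ (c ∷ v)))
                         ≡ countₛ (λ S → Q? (c ∷ S) ×-dec ¬? (S ≟ₛ v))
    without-∷-same c = countₛ-cong (λ S → Q? (c ∷ S) ×-dec ¬? ((c ∷ S) ≟ₛ (c ∷ v)))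
      (λ S → Q? (c ∷ S) ×-dec ¬? (S ≟ₛ v)) λ S → ⇔-refl ×-⇔ ∷≢∷⇔≢

    without-∷-other : ∀ {c d} → c ≢ d → countₛ (λ S → Q? (c ∷ S) ×-dec ¬? ((c ∷ S) ≟ₛ (d ∷ v)))
                                      ≡ countₛ (λ S → Q? (c ∷ S))
    without-∷-other {c} {d} c≢d = countₛ-cong (λ S → Q? (c ∷ S) ×-dec ¬? ((c ∷ S) ≟ₛ (d ∷ v)))
      (λ S → Q? (c ∷ S)) λ S → mk⇔ proj₁ (_, c≢d ∘ proj₁ ∘ ∷-injective)

countₛ-remove : {Q : Pred (Subset n) a} (Q? : Decidable Q) {v : Subset n} → Q v →
                countₛ Q? ≡ suc (countₛ (λ S → Q? S ×-dec ¬? (S ≟ₛ v)))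
countₛ-remove {n = zero} Q? {[]} Qv rewrite dec-true (Q? []) Qv = refl
countₛ-remove {n = suc n} Q? {false ∷ v} Qv = cong₂ _+_
  (trans (countₛ-remove (λ S → Q? (false ∷ S)) Qv) (cong suc (sym (without-∷-same Q? v false))))
  (sym (without-∷-other Q? v λ ()))
countₛ-remove {n = suc n} Q? {true ∷ v} Qv = trans (cong₂ _+_
  (sym (without-∷-other Q? v λ ()))
  (trans (countₛ-remove (λ S → Q? (true ∷ S)) Qv) (cong suc (sym (without-∷-same Q? v true)))))
  (+-suc _ _)

∣p∣≡countₛ-by-bijection :
  {Q : Pred (Subset m) a} (Q? : Decidable Q) (p : Subset n) (f : Fin n → Subset m) →
  (∀ {x} → x ∈ p → Q (f x)) →
  (∀ {x y} → x ∈ p → y ∈ p → f x ≡ f y → x ≡ y) →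
  (∀ {S} → Q S → ∃ λ x → x ∈ p × f x ≡ S) →
  ∣ p ∣ ≡ countₛ Q?
∣p∣≡countₛ-by-bijection Q? [] f into inj onto =
  sym (countₛ-empty Q? λ S QS → case onto QS of λ ())
∣p∣≡countₛ-by-bijection {Q = Q} Q? (false ∷ p) f into inj onto =
  ∣p∣≡countₛ-by-bijection Q? p (f ∘ suc) (into ∘ there)
    (λ x∈p y∈p → suc-injective ∘ inj (there x∈p) (there y∈p)) onto′
  where
  onto′ : ∀ {S} → Q S → ∃ λ x → x ∈ p × f (suc x) ≡ S
  onto′ QS with onto QS
  ... | suc x , there x∈p , fx≡S = x , x∈p , fx≡S
∣p∣≡countₛ-by-bijection {Q = Q} Q? (true ∷ p) f into inj onto =
  trans (cong suc counts-without-f0) (sym (countₛ-remove Q? (into here)))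
  where
  Q′? : Decidable (λ S → Q S × S ≢ f zero)
  Q′? S = Q? S ×-dec ¬? (S ≟ₛ f zero)
  into′ : ∀ {x} → x ∈ p → Q (f (suc x)) × f (suc x) ≢ f zero
  into′ x∈p = into (there x∈p) , λ e → 0≢1+n (inj here (there x∈p) (sym e))
  onto′ : ∀ {S} → Q S × S ≢ f zero → ∃ λ x → x ∈ p × f (suc x) ≡ S
  onto′ (QS , S≢f0) with onto QS
  ... | zero , _ , f0≡S = ⊥-elim (S≢f0 (sym f0≡S))
  ... | suc x , there x∈p , fx≡S = x , x∈p , fx≡S
  counts-without-f0 : ∣ p ∣ ≡ countₛ Q′?
  counts-without-f0 = ∣p∣≡countₛ-by-bijection Q′? p (f ∘ suc) into′
    (λ x∈p y∈p → suc-injective ∘ inj (there x∈p) (there y∈p)) onto′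

private
  ⊆∧∣∣≡? : (q : Subset n) (k : ℕ) → Decidable (λ S → S ⊆ q × ∣ S ∣ ≡ k)
  ⊆∧∣∣≡? q k S = S ⊆? q ×-dec ∣ S ∣ ≟ℕ k

  countₛ-outside-head : ∀ b (q : Subset n) k →
    countₛ (λ S → ⊆∧∣∣≡? (b ∷ q) k (false ∷ S)) ≡ countₛ (⊆∧∣∣≡? q k)
  countₛ-outside-head b q k = countₛ-cong _ (⊆∧∣∣≡? q k) λ S → ⇔-sym out⊆-⇔ ×-⇔ ⇔-refl

countₛ-⊆∧∣∣≡ : (q : Subset n) (k : ℕ) → countₛ (λ S → S ⊆? q ×-dec ∣ S ∣ ≟ℕ k) ≡ ∣ q ∣ C k
countₛ-⊆∧∣∣≡ [] zero = refl
countₛ-⊆∧∣∣≡ [] (suc k) = refl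
countₛ-⊆∧∣∣≡ (false ∷ q) k = trans
  (cong₂ _+_ (trans (countₛ-outside-head false q k) (countₛ-⊆∧∣∣≡ q k))
             (countₛ-empty (λ S → ⊆∧∣∣≡? (false ∷ q) k (true ∷ S))
               λ S (⊆ , _) → case ⊆ here of λ ()))
  (+-identityʳ _)
countₛ-⊆∧∣∣≡ (true ∷ q) zero =
  cong₂ _+_ (trans (countₛ-outside-head true q zero) (countₛ-⊆∧∣∣≡ q zero))
            (countₛ-empty (λ S → ⊆∧∣∣≡? (true ∷ q) zero (true ∷ S)) λ { S (_ , ()) })
countₛ-⊆∧∣∣≡ (true ∷ q) (suc k) = trans
  (cong₂ _+_ (trans (countₛ-outside-head true q (suc k)) (countₛ-⊆∧∣∣≡ q (suc k)))
             (trans (countₛ-cong _ (⊆∧∣∣≡? q k)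
                      λ S → ⇔-sym in⊆in-⇔ ×-⇔ mk⇔ suc-injectiveℕ (cong suc))
                    (countₛ-⊆∧∣∣≡ q k)))
  (trans (+-comm (∣ q ∣ C suc k) (∣ q ∣ C k)) (nCk+nC[k+1]≡[n+1]C[k+1] ∣ q ∣ k))

swap-left : (p q : Fin n) → swap p q p ≡ q
swap-left p q with p ≟ p
... | yes _ = refl
... | no p≢p = ⊥-elim (p≢p refl)

swap-other : (p q : Fin n) → x ≢ p → x ≢ q → swap p q x ≡ x
swap-other {x = x} p q x≢p x≢q with x ≟ p | x ≟ q
... | yes x≡p | _ = ⊥-elim (x≢p x≡p)
... | no _ | yes x≡q = ⊥-elim (x≢q x≡q)
... | no _ | no _ = refl

3-cycle : Fin n → Fin n → Fin n → Fin n → Fin n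
3-cycle p q r = swap p q ∘ swap q r

module _ {p q r : Fin n} where

  3-cycle-first : p ≢ q → p ≢ r → 3-cycle p q r p ≡ q
  3-cycle-first p≢q p≢r = trans (cong (swap p q) (swap-other q r p≢q p≢r)) (swap-left p q)

  3-cycle-second : p ≢ r → q ≢ r → 3-cycle p q r q ≡ r
  3-cycle-second p≢r q≢r =
    trans (cong (swap p q) (swap-left q r)) (swap-other p q (p≢r ∘ sym) (q≢r ∘ sym))

  3-cycle-other : x ≢ p → x ≢ q → x ≢ r → 3-cycle p q r x ≡ x
  3-cycle-other x≢p x≢q x≢r =
    trans (cong (swap p q) (swap-other q r x≢q x≢r)) (swap-other p q x≢p x≢q)

Image : (Fin n → Fin n) → Pred (Fin n) a → Pred (Fin n) a
Image σ T y = ∃ λ x → T x × σ x ≡ y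

module _ {T : Pred (Fin n) a} {p q r : Fin n} where

  private
    separated : T x → ¬ T y → x ≢ y
    separated Tx ¬Ty x≡y = ¬Ty (subst T x≡y Tx)

  3-cycle-image-entering : T p → ¬ T q → ¬ T r → q ≢ r →
                           ∀ y → Image (3-cycle p q r) T y ⇔ ((T y × y ≢ p) ⊎ y ≡ q)
  3-cycle-image-entering Tp ¬Tq ¬Tr q≢r y = mk⇔ image⇒ ⇒image
    where
    p≢q : p ≢ q
    p≢q = separated Tp ¬Tq
    p≢r : p ≢ r
    p≢r = separated Tp ¬Tr
    image⇒ : Image (3-cycle p q r) T y → (T y × y ≢ p) ⊎ y ≡ q
    image⇒ (x , Tx , σx≡y) with x ≟ p
    ... | yes refl = inj₂ (trans (sym σx≡y) (3-cycle-first p≢q p≢r))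
    ... | no x≢p = inj₁ (subst (λ z → T z × z ≢ p)
      (trans (sym (3-cycle-other x≢p (separated Tx ¬Tq) (separated Tx ¬Tr))) σx≡y) (Tx , x≢p))
    ⇒image : (T y × y ≢ p) ⊎ y ≡ q → Image (3-cycle p q r) T y
    ⇒image (inj₁ (Ty , y≢p)) = y , Ty , 3-cycle-other y≢p (separated Ty ¬Tq) (separated Ty ¬Tr)
    ⇒image (inj₂ refl) = p , Tp , 3-cycle-first p≢q p≢r

  3-cycle-image-passing : T p → T q → ¬ T r → p ≢ q →
                          ∀ y → Image (3-cycle p q r) T y ⇔ ((T y × y ≢ p) ⊎ y ≡ r)
  3-cycle-image-passing Tp Tq ¬Tr p≢q y = mk⇔ image⇒ ⇒image
    where
    p≢r : p ≢ r
    p≢r = separated Tp ¬Tr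
    q≢r : q ≢ r
    q≢r = separated Tq ¬Tr
    image⇒ : Image (3-cycle p q r) T y → (T y × y ≢ p) ⊎ y ≡ r
    image⇒ (x , Tx , σx≡y) with x ≟ p
    ... | yes refl =
      inj₁ (subst (λ z → T z × z ≢ p) (trans (sym (3-cycle-first p≢q p≢r)) σx≡y) (Tq , p≢q ∘ sym))
    ... | no x≢p with toSum (x ≟ q)
    ...   | inj₁ refl = inj₂ (trans (sym σx≡y) (3-cycle-second p≢r q≢r))
    ...   | inj₂ x≢q = inj₁ (subst (λ z → T z × z ≢ p)
      (trans (sym (3-cycle-other x≢p x≢q (separated Tx ¬Tr))) σx≡y) (Tx , x≢p))
    ⇒image : (T y × y ≢ p) ⊎ y ≡ r → Image (3-cycle p q r) T y
    ⇒image (inj₁ (Ty , y≢p)) with toSum (y ≟ q)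
    ... | inj₁ refl = p , Tp , 3-cycle-first p≢q p≢r
    ... | inj₂ y≢q = y , Ty , 3-cycle-other y≢p y≢q (separated Ty ¬Tr)
    ⇒image (inj₂ refl) = q , Tq , 3-cycle-second p≢r q≢r

module Height1Poset {n} (P : FinPoset n)
  (no-3-chain : ¬ (∃ λ x → ∃ λ y → ∃ λ z → FinPoset._<_ P x y × FinPoset._<_ P y z)) where

  open FinPoset P using () renaming (_<_ to _≺_; _<?_ to _≺?_)

  ≺⇒minimal : x ≺ y → Minimal P x
  ≺⇒minimal x≺y z z≺x = no-3-chain (z , _ , _ , z≺x , x≺y)

  ≺⇒¬minimal : x ≺ y → ¬ Minimal P y
  ≺⇒¬minimal {x = x} x≺y min-y = min-y x x≺y

  ¬minimal⇒∃≺ : ¬ Minimal P x → ∃ λ y → y ≺ x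
  ¬minimal⇒∃≺ {x = x} ¬min with any? (λ y → y ≺? x)
  ... | yes below = below
  ... | no nothing-below = ⊥-elim (¬min λ y y≺x → nothing-below (y , y≺x))

  ¬minimal⇒maximal : ¬ Minimal P x → Maximal P x
  ¬minimal⇒maximal ¬min y x≺y = ¬min (≺⇒minimal x≺y)

  ∈R₀⇒minimal : x ∈ R₀ P → Minimal P x
  ∈R₀⇒minimal = Equivalence.to (∈-tabulate-does (minimal? P))

  minimal⇒∈R₀ : Minimal P x → x ∈ R₀ P
  minimal⇒∈R₀ = Equivalence.from (∈-tabulate-does (minimal? P))

  ∈R₁⇔¬minimal : x ∈ R₁ P ⇔ (¬ Minimal P x)
  ∈R₁⇔¬minimal =
    ⇔-trans (∈-tabulate-does (InR₁? P)) (mk⇔ proj₁ (λ ¬min → ¬min , λ _ → ≺⇒minimal))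

  ∈MinBelow⇒≺ : y ∈ MinBelow P x → y ≺ x
  ∈MinBelow⇒≺ {x = x} = proj₂ ∘ Equivalence.to (∈-tabulate-does (λ y → minimal? P y ×-dec y ≺? x))

  ≺⇒∈MinBelow : y ≺ x → y ∈ MinBelow P x
  ≺⇒∈MinBelow {x = x} y≺x =
    Equivalence.from (∈-tabulate-does (λ y → minimal? P y ×-dec y ≺? x)) (≺⇒minimal y≺x , y≺x)

  MinBelow⊆R₀ : MinBelow P x ⊆ R₀ P
  MinBelow⊆R₀ = minimal⇒∈R₀ ∘ ≺⇒minimal ∘ ∈MinBelow⇒≺

  MinBelow-injective : (∀ A → Antichain P A → OrderAutonomous P A → Nontrivial P A → ⊥) →
                       ¬ Minimal P x → ¬ Minimal P y → MinBelow P x ≡ MinBelow P y → x ≡ y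
  MinBelow-injective {x = x} {y = y} no-autonomous ¬min-x ¬min-y same-below with x ≟ y
  ... | yes x≡y = x≡y
  ... | no x≢y = ⊥-elim (no-autonomous pair antichain autonomous (size≢1 , size≢n))
    where
    pair : Subset n
    pair = ⁅ x ⁆ ∪ ⁅ y ⁆
    x∈pair : x ∈ pair
    x∈pair = x∈p∪q⁺ (inj₁ (x∈⁅x⁆ x))
    y∈pair : y ∈ pair
    y∈pair = x∈p∪q⁺ (inj₂ (x∈⁅x⁆ y))
    pair-cases : ∀ {z} → z ∈ pair → z ≡ x ⊎ z ≡ y
    pair-cases z∈pair with x∈p∪q⁻ ⁅ x ⁆ ⁅ y ⁆ z∈pair
    ... | inj₁ z∈⁅x⁆ = inj₁ (x∈⁅y⁆⇒x≡y x z∈⁅x⁆)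
    ... | inj₂ z∈⁅y⁆ = inj₂ (x∈⁅y⁆⇒x≡y y z∈⁅y⁆)
    ¬minimal-in-pair : ∀ {z} → z ∈ pair → ¬ Minimal P z
    ¬minimal-in-pair z∈pair with pair-cases z∈pair
    ... | inj₁ refl = ¬min-x
    ... | inj₂ refl = ¬min-y
    below-in-pair : ∀ {z} → z ∈ pair → MinBelow P z ≡ MinBelow P x
    below-in-pair z∈pair with pair-cases z∈pair
    ... | inj₁ refl = refl
    ... | inj₂ refl = sym same-below
    below-all : ∀ {m a b} → a ∈ pair → b ∈ pair → m ≺ a → m ≺ b
    below-all {m} a∈pair b∈pair = ∈MinBelow⇒≺ ∘
      subst (m ∈_) (trans (below-in-pair a∈pair) (sym (below-in-pair b∈pair))) ∘ ≺⇒∈MinBelow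
    antichain : Antichain P pair
    antichain a _ a∈pair _ a≺b = ¬minimal-in-pair a∈pair (≺⇒minimal a≺b)
    autonomous : OrderAutonomous P pair
    autonomous = (x , x∈pair) , λ z _ →
      (λ { (a , a∈pair , z≺a) b b∈pair → below-all a∈pair b∈pair z≺a }) ,
      (λ { (a , a∈pair , a≺z) → ⊥-elim (¬minimal-in-pair a∈pair (≺⇒minimal a≺z)) })
    size≢1 : ¬ (∣ pair ∣ ≡ 1)
    size≢1 ∣pair∣≡1 =
      x≢y (sym (x∈⁅y⁆⇒x≡y x (subst (y ∈_) (x∈p∧∣p∣≡1⇒p≡⁅x⁆ x∈pair ∣pair∣≡1) y∈pair)))
    size≢n : ¬ (∣ pair ∣ ≡ n)
    size≢n ∣pair∣≡n with ¬minimal⇒∃≺ ¬min-x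
    ... | m , m≺x =
      ¬minimal-in-pair (subst (m ∈_) (sym (∣p∣≡n⇒p≡⊤ ∣pair∣≡n)) ∈⊤) (≺⇒minimal m≺x)

  MinBelow-image : (Φ : Aut P) {σ : Fin n → Fin n} → (∀ m → m ∈ R₀ P → Aut.to Φ m ≡ σ m) →
                   ∀ x y → y ∈ MinBelow P (Aut.to Φ x) ⇔ Image σ (_∈ MinBelow P x) y
  MinBelow-image Φ {σ} agrees x y = mk⇔ below⇒image image⇒below
    where
    open Aut Φ
    open Inverse perm using (from; strictlyInverseˡ)
    σ-on-below : ∀ {m} → m ∈ MinBelow P x → to m ≡ σ m
    σ-on-below m∈ = agrees _ (MinBelow⊆R₀ m∈)
    below⇒image : y ∈ MinBelow P (to x) → Image σ (_∈ MinBelow P x) y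
    below⇒image y∈ = from y , from-y∈ , trans (sym (σ-on-below from-y∈)) (strictlyInverseˡ y)
      where
      from-y∈ : from y ∈ MinBelow P x
      from-y∈ = ≺⇒∈MinBelow (reflect (from y) x
        (subst (_≺ to x) (sym (strictlyInverseˡ y)) (∈MinBelow⇒≺ y∈)))
    image⇒below : Image σ (_∈ MinBelow P x) y → y ∈ MinBelow P (to x)
    image⇒below (m , m∈ , σm≡y) = ≺⇒∈MinBelow
      (subst (_≺ to x) (trans (σ-on-below m∈) σm≡y) (preserve m x (∈MinBelow⇒≺ m∈)))

  module _ (three : 3 ≤ ∣ R₀ P ∣)
    (alternating : ∀ σ → EvenPermOn (R₀ P) σ →
                   Σ (Aut P) λ Φ → ∀ x → x ∈ R₀ P → Aut.to Φ x ≡ σ x) where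

    MinBelow-3-cycle : ∀ {p q r} → p ∈ R₀ P → q ∈ R₀ P → r ∈ R₀ P → p ≢ q → q ≢ r →
      ∀ x → ∃ λ y → ∀ m → m ∈ MinBelow P y ⇔ Image (3-cycle p q r) (_∈ MinBelow P x) m
    MinBelow-3-cycle {p} {q} {r} p∈ q∈ r∈ p≢q q≢r x
      with alternating (3-cycle p q r) (stepE p q q r p∈ q∈ q∈ r∈ p≢q q≢r idE)
    ... | Φ , agrees = Aut.to Φ x , MinBelow-image Φ agrees x

    MinBelow-exchange : ∀ {a b} → a ∈ MinBelow P x → b ∈ R₀ P → b ∉ MinBelow P x →
      ∃ λ y → ∀ m → m ∈ MinBelow P y ⇔ ((m ∈ MinBelow P x × m ≢ a) ⊎ m ≡ b)
    -- With e a third minimal element, use the 3-cycle a ↦ b ↦ e ↦ a if e ∉ MinBelow x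
    -- and a ↦ e ↦ b ↦ a if e ∈ MinBelow x; either way a is exchanged for b.
    MinBelow-exchange {x = x} {a} {b} a∈ b∈R₀ b∉ with 3≤∣p∣⇒∃z∈p∖⁅x,y⁆ three a b
    ... | e , e∈R₀ , e≢a , e≢b with e ∈? MinBelow P x
    ... | no e∉ =
      map₂ (λ moves m → ⇔-trans (moves m) (3-cycle-image-entering a∈ b∉ e∉ (e≢b ∘ sym) m))
           (MinBelow-3-cycle a∈R₀ b∈R₀ e∈R₀ a≢b (e≢b ∘ sym) x)
      where
      a∈R₀ : a ∈ R₀ P
      a∈R₀ = MinBelow⊆R₀ a∈
      a≢b : a ≢ b
      a≢b refl = b∉ a∈
    ... | yes e∈ =
      map₂ (λ moves m → ⇔-trans (moves m) (3-cycle-image-passing a∈ e∈ b∉ (e≢a ∘ sym) m))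
           (MinBelow-3-cycle (MinBelow⊆R₀ a∈) e∈R₀ b∈R₀ (e≢a ∘ sym) e≢b x)

    module _ {ℓ} (uniform : ∀ x → Maximal P x → ∣ MinBelow P x ∣ ≡ ℓ)
                 (some-nonminimal : ∃ λ x → ¬ Minimal P x) where

      ∣MinBelow∣≡ℓ : ¬ Minimal P x → ∣ MinBelow P x ∣ ≡ ℓ
      ∣MinBelow∣≡ℓ = uniform _ ∘ ¬minimal⇒maximal

      MinBelow-surjective : ∀ {S} → S ⊆ R₀ P → ∣ S ∣ ≡ ℓ →
                            ∃ λ y → ¬ Minimal P y × MinBelow P y ≡ S
      MinBelow-surjective {S} S⊆R₀ ∣S∣≡ℓ =
        approach (suc ∣ S ─ MinBelow P (proj₁ some-nonminimal) ∣) _ (proj₂ some-nonminimal) ≤-refl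
        where
        approach : ∀ k x → ¬ Minimal P x → ∣ S ─ MinBelow P x ∣ < k →
                   ∃ λ y → ¬ Minimal P y × MinBelow P y ≡ S
        approach (suc k) x ¬min-x bound with S ⊆? MinBelow P x
        ... | yes S⊆ =
          x , ¬min-x , sym (p⊆q∧∣q∣≤∣p∣⇒p≡q S⊆ (≤-reflexive (trans (∣MinBelow∣≡ℓ ¬min-x) (sym ∣S∣≡ℓ))))
        ... | no S⊈
          with ⊈⇒∃∈∉ S⊈ | ⊈⇒∃∈∉ (p⊈q∧∣p∣≡∣q∣⇒q⊈p S⊈ (trans ∣S∣≡ℓ (sym (∣MinBelow∣≡ℓ ¬min-x))))
        ... | b , b∈S , b∉ | a , a∈ , a∉S with MinBelow-exchange a∈ (S⊆R₀ b∈S) b∉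
        ... | y , exchanged = approach k y ¬min-y (<-≤-trans closer (≤-pred bound))
          where
          b∈y : b ∈ MinBelow P y
          b∈y = Equivalence.from (exchanged b) (inj₂ refl)
          ¬min-y : ¬ Minimal P y
          ¬min-y min-y = min-y b (∈MinBelow⇒≺ b∈y)
          closer : ∣ S ─ MinBelow P y ∣ < ∣ S ─ MinBelow P x ∣
          closer = p⊂q⇒∣p∣<∣q∣ (exchange-─⊂ a∉S b∈S b∉ exchanged)

      module Classification
        (no-autonomous : ∀ A → Antichain P A → OrderAutonomous P A → Nontrivial P A → ⊥) where

        ∣R₁∣≡∣R₀∣Cℓ : ∣ R₁ P ∣ ≡ ∣ R₀ P ∣ C ℓ
        ∣R₁∣≡∣R₀∣Cℓ = trans
          (∣p∣≡countₛ-by-bijection (λ S → S ⊆? R₀ P ×-dec ∣ S ∣ ≟ℕ ℓ) (R₁ P) (MinBelow P)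
            (λ x∈R₁ → MinBelow⊆R₀ , ∣MinBelow∣≡ℓ (¬minimal x∈R₁))
            (λ x∈R₁ y∈R₁ → MinBelow-injective no-autonomous (¬minimal x∈R₁) (¬minimal y∈R₁))
            (λ (S⊆R₀ , ∣S∣≡ℓ) →
              map₂ (map₁ (Equivalence.from ∈R₁⇔¬minimal)) (MinBelow-surjective S⊆R₀ ∣S∣≡ℓ)))
          (countₛ-⊆∧∣∣≡ (R₀ P) ℓ)
          where
          ¬minimal : x ∈ R₁ P → ¬ Minimal P x
          ¬minimal = Equivalence.to ∈R₁⇔¬minimal

        label : Fin n → Subset n
        label x with minimal? P x
        ... | yes _ = ⁅ x ⁆
        ... | no _ = MinBelow P x

        label-minimal : Minimal P x → label x ≡ ⁅ x ⁆
        label-minimal {x = x} min with minimal? P x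
        ... | yes _ = refl
        ... | no ¬min = ⊥-elim (¬min min)

        label-¬minimal : ¬ Minimal P x → label x ≡ MinBelow P x
        label-¬minimal {x = x} ¬min with minimal? P x
        ... | yes min = ⊥-elim (¬min min)
        ... | no _ = refl

        ⁅x⁆⊆R₀ : Minimal P x → ⁅ x ⁆ ⊆ R₀ P
        ⁅x⁆⊆R₀ = x∈p⇒⁅x⁆⊆p ∘ minimal⇒∈R₀

        module _ (2≤ℓ : 2 ≤ ℓ) where

          1≢ℓ : 1 ≢ ℓ
          1≢ℓ refl = <-irrefl refl 2≤ℓ

          label-shape : ∀ x → label x ⊆ R₀ P × (∣ label x ∣ ≡ 1 ⊎ ∣ label x ∣ ≡ ℓ)
          label-shape x with minimal? P x
          ... | yes min = ⁅x⁆⊆R₀ min , inj₁ (∣⁅x⁆∣≡1 x)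
          ... | no ¬min = MinBelow⊆R₀ , inj₂ (∣MinBelow∣≡ℓ ¬min)

          label-injective : ∀ x y → label x ≡ label y → x ≡ y
          label-injective x y same with minimal? P x | minimal? P y
          ... | yes _ | yes _ = ⁅⁆-injective same
          ... | yes _ | no ¬min-y =
            ⊥-elim (1≢ℓ (trans (sym (∣⁅x⁆∣≡1 x)) (trans (cong ∣_∣ same) (∣MinBelow∣≡ℓ ¬min-y))))
          ... | no ¬min-x | yes _ =
            ⊥-elim (1≢ℓ (trans (sym (∣⁅x⁆∣≡1 y)) (trans (cong ∣_∣ (sym same)) (∣MinBelow∣≡ℓ ¬min-x))))
          ... | no ¬min-x | no ¬min-y = MinBelow-injective no-autonomous ¬min-x ¬min-y same

          label-surjective : ∀ S → S ⊆ R₀ P → ∣ S ∣ ≡ 1 ⊎ ∣ S ∣ ≡ ℓ → ∃ λ x → label x ≡ S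
          label-surjective S S⊆R₀ (inj₁ ∣S∣≡1) with ∣p∣≡1⇒∃⁅x⁆ {p = S} ∣S∣≡1
          ... | z , refl = z , label-minimal (∈R₀⇒minimal (S⊆R₀ (x∈⁅x⁆ z)))
          label-surjective S S⊆R₀ (inj₂ ∣S∣≡ℓ) with MinBelow-surjective S⊆R₀ ∣S∣≡ℓ
          ... | y , ¬min-y , refl = y , label-¬minimal ¬min-y

          label-order : ∀ x y → (x ≺ y → label x ⊂ label y) × (label x ⊂ label y → x ≺ y)
          label-order x y = ≺⇒⊂ , ⊂⇒≺
            where
            ≺⇒⊂ : x ≺ y → label x ⊂ label y
            ≺⇒⊂ x≺y rewrite label-minimal (≺⇒minimal x≺y) | label-¬minimal (≺⇒¬minimal x≺y) =
              x∈p∧2≤∣p∣⇒⁅x⁆⊂p (≺⇒∈MinBelow x≺y)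
                (subst (2 ≤_) (sym (∣MinBelow∣≡ℓ (≺⇒¬minimal x≺y))) 2≤ℓ)
            ⊂⇒≺ : label x ⊂ label y → x ≺ y
            ⊂⇒≺ x⊂y with minimal? P x | minimal? P y
            ... | yes _ | no _ = ∈MinBelow⇒≺ (proj₁ x⊂y (x∈⁅x⁆ x))
            ... | yes _ | yes _ =
              ⊥-elim (<-irrefl (trans (∣⁅x⁆∣≡1 x) (sym (∣⁅x⁆∣≡1 y))) (p⊂q⇒∣p∣<∣q∣ x⊂y))
            ... | no ¬min-x | no ¬min-y =
              ⊥-elim (<-irrefl (trans (∣MinBelow∣≡ℓ ¬min-x) (sym (∣MinBelow∣≡ℓ ¬min-y)))
                               (p⊂q⇒∣p∣<∣q∣ x⊂y))
            ... | no ¬min-x | yes _ = ⊥-elim (<⇒≱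
              (subst₂ _<_ (∣MinBelow∣≡ℓ ¬min-x) (∣⁅x⁆∣≡1 y) (p⊂q⇒∣p∣<∣q∣ x⊂y)) (≤-trans (n≤1+n 1) 2≤ℓ))

          isoToSubsetPoset : IsoToSubsetPoset P ℓ
          isoToSubsetPoset = label , label-shape , label-injective , label-surjective , label-order

        module _ (ℓ≡1 : ℓ ≡ 1) where

          lower-cover : ¬ Minimal P x → ∃ λ c → MinBelow P x ≡ ⁅ c ⁆
          lower-cover {x = x} ¬min = ∣p∣≡1⇒∃⁅x⁆ {p = MinBelow P x} (trans (∣MinBelow∣≡ℓ ¬min) ℓ≡1)

          lower : ¬ Minimal P x → Fin n
          lower = proj₁ ∘ lower-cover

          MinBelow≡⁅lower⁆ : (¬min : ¬ Minimal P x) → MinBelow P x ≡ ⁅ lower ¬min ⁆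
          MinBelow≡⁅lower⁆ = proj₂ ∘ lower-cover

          lower∈R₀ : (¬min : ¬ Minimal P x) → lower ¬min ∈ R₀ P
          lower∈R₀ ¬min = MinBelow⊆R₀ (subst (lower ¬min ∈_) (sym (MinBelow≡⁅lower⁆ ¬min)) (x∈⁅x⁆ _))

          upper : ∀ c → c ∈ R₀ P → ∃ λ y → ¬ Minimal P y × MinBelow P y ≡ ⁅ c ⁆
          upper c c∈R₀ = MinBelow-surjective (x∈p⇒⁅x⁆⊆p c∈R₀) (trans (∣⁅x⁆∣≡1 c) (sym ℓ≡1))

          toWC₂ : Fin n → Fin ∣ R₀ P ∣ × Bool
          toWC₂ x with minimal? P x
          ... | yes min = index (R₀ P) (minimal⇒∈R₀ min) , false
          ... | no ¬min = index (R₀ P) (lower∈R₀ ¬min) , true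

          fromWC₂ : Fin ∣ R₀ P ∣ × Bool → Fin n
          fromWC₂ (i , false) = enum (R₀ P) i
          fromWC₂ (i , true) = proj₁ (upper (enum (R₀ P) i) (enum∈ (R₀ P) i))

          toWC₂∘fromWC₂ : ∀ v → toWC₂ (fromWC₂ v) ≡ v
          toWC₂∘fromWC₂ (i , false) with minimal? P (enum (R₀ P) i)
          ... | yes _ = cong (_, false) (index-enum (R₀ P) i _)
          ... | no ¬min = ⊥-elim (¬min (∈R₀⇒minimal (enum∈ (R₀ P) i)))
          toWC₂∘fromWC₂ (i , true) with upper (enum (R₀ P) i) (enum∈ (R₀ P) i)
          ... | y , ¬min-y , below≡⁅eᵢ⁆ with minimal? P y
          ...   | yes min-y = ⊥-elim (¬min-y min-y)
          ...   | no ¬min = cong (_, true) (trans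
                    (index-cong (R₀ P) (lower∈R₀ ¬min) (enum∈ (R₀ P) i)
                      (⁅⁆-injective (trans (sym (MinBelow≡⁅lower⁆ ¬min)) below≡⁅eᵢ⁆)))
                    (index-enum (R₀ P) i _))

          fromWC₂∘toWC₂ : ∀ x → fromWC₂ (toWC₂ x) ≡ x
          fromWC₂∘toWC₂ x with minimal? P x
          ... | yes min = enum-index (R₀ P) _
          ... | no ¬min with upper (enum (R₀ P) (index (R₀ P) (lower∈R₀ ¬min))) (enum∈ (R₀ P) _)
          ...   | y , ¬min-y , below-y≡ = MinBelow-injective no-autonomous ¬min-y ¬min
                    (trans below-y≡ (trans (cong ⁅_⁆ (enum-index (R₀ P) _)) (sym (MinBelow≡⁅lower⁆ ¬min))))

          toWC₂-order : ∀ x y → (x ≺ y → toWC₂ x <wC₂ toWC₂ y) × (toWC₂ x <wC₂ toWC₂ y → x ≺ y)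
          toWC₂-order x y with minimal? P x | minimal? P y
          ... | yes min-x | no ¬min-y = ≺⇒same-index , same-index⇒≺
            where
            same-index : Set
            same-index = index (R₀ P) (minimal⇒∈R₀ min-x) ≡ index (R₀ P) (lower∈R₀ ¬min-y)
            ≺⇒same-index : x ≺ y → same-index
            ≺⇒same-index x≺y = index-cong (R₀ P) _ _
              (x∈⁅y⁆⇒x≡y _ (subst (x ∈_) (MinBelow≡⁅lower⁆ ¬min-y) (≺⇒∈MinBelow x≺y)))
            same-index⇒≺ : same-index → x ≺ y
            same-index⇒≺ same = ∈MinBelow⇒≺ (subst (x ∈_) (sym (MinBelow≡⁅lower⁆ ¬min-y))
              (subst (_∈ ⁅ _ ⁆) (sym (index-injective (R₀ P) _ _ same)) (x∈⁅x⁆ _)))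
          ... | yes _ | yes min-y = (λ x≺y → ≺⇒¬minimal x≺y min-y) , λ ()
          ... | no ¬min-x | _ = (λ x≺y → ¬min-x (≺⇒minimal x≺y)) , λ ()

          isoToWC₂ : IsoToWC₂ P ∣ R₀ P ∣
          isoToWC₂ = mk↔ₛ′ toWC₂ fromWC₂ toWC₂∘fromWC₂ fromWC₂∘toWC₂ , toWC₂-order

lemma2p5 : ∀ {n} (P : FinPoset n) (w ℓ : ℕ) →
  Height1 P →
  ∣ R₀ P ∣ ≡ w → 3 ≤ w →
  1 ≤ ℓ → ℓ < w →
  (∀ x → Maximal P x → ∣ MinBelow P x ∣ ≡ ℓ) →
  (∀ A → Antichain P A → OrderAutonomous P A → Nontrivial P A → ⊥) →
  (∀ σ → EvenPermOn (R₀ P) σ →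
    Σ (Aut P) λ Φ → ∀ x → x ∈ R₀ P → Aut.to Φ x ≡ σ x) →
  (∣ R₁ P ∣ ≡ w C ℓ)
    × (2 ≤ ℓ → IsoToSubsetPoset P ℓ)
    × (ℓ ≡ 1 → IsoToWC₂ P w)
lemma2p5 P w ℓ ((x , y , x<y) , no-3-chain) refl three _ _ uniform no-autonomous alternating =
  ∣R₁∣≡∣R₀∣Cℓ , isoToSubsetPoset , isoToWC₂
  where
  open Height1Poset P no-3-chain
  some-nonminimal : ∃ λ y → ¬ Minimal P y
  some-nonminimal = y , ≺⇒¬minimal x<y
  open Classification three alternating uniform some-nonminimal no-autonomous
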